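{- Let $\mathbf{e}$ be a transitive relation on a set $E$. The lattice $\mathrm{Reg}(\mathbf{e})$ is, up to isomorphism, the Dedekind–MacNeille completion of the poset $\mathrm{Clop}(\mathbf{e})$ (via the inclusion $\mathrm{Clop}(\mathbf{e})\subseteq\mathrm{Reg}(\mathbf{e})$). In particular, every completely join-irreducible element of $\mathrm{Reg}(\mathbf{e})$ is clopen.
   Context: A transitive relation $\mathbf{e}$ on $E$ is viewed as a set of ordered pairs. A subset $\mathbf{a}\subseteq\mathbf{e}$ is closed if transitive, open if $\mathbf{e}\setminus\mathbf{a}$ is transitive, clopen if both. $\mathrm{cl}$ is transitive closure, $\mathrm{int}(\mathbf{a})$ the largest open subset of $\mathbf{a}$; $\mathbf{a}$ is regular closed if $\mathbf{a}=\mathrm{cl}(\mathrm{int}(\mathbf{a}))$. $\mathrm{Reg}(\mathbf{e})$ (resp. $\mathrm{Clop}(\mathbf{e})$) is the set of regular closed (resp. clopen) subsets of $\mathbf{e}$ ordered by inclusion; $\mathrm{Reg}(\mathbf{e})$ is a complete lattice with $\bigvee_i\mathbf{a}_i=\mathrm{cl}(\bigcup_i\mathbf{a}_i)$ and $\bigwedge_i\mathbf{a}_i=\mathrm{cl}(\mathrm{int}(\bigcap_i\mathbf{a}_i))$, and every clopen set is regular closed. -}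

module Defs where

open import Level using (Level; _⊔_; 0ℓ) renaming (suc to lsuc)
open import Data.Product using (Σ; _×_; _,_; proj₁; proj₂)
open import Relation.Nullary using (¬_)
open import Relation.Binary.Core using (Rel)
open import Relation.Binary.Definitions using (Transitive)
open import Relation.Binary.Construct.Closure.Transitive using (TransClosure)

_⊆ʳ_ : ∀ {a ℓ₁ ℓ₂} {E : Set a} → Rel E ℓ₁ → Rel E ℓ₂ → Set (a ⊔ ℓ₁ ⊔ ℓ₂)
r ⊆ʳ s = ∀ {x y} → r x y → s x y

_≐ʳ_ : ∀ {a ℓ₁ ℓ₂} {E : Set a} → Rel E ℓ₁ → Rel E ℓ₂ → Set (a ⊔ ℓ₁ ⊔ ℓ₂)
r ≐ʳ s = (r ⊆ʳ s) × (s ⊆ʳ r)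

_∖ʳ_ : ∀ {a ℓ₁ ℓ₂} {E : Set a} → Rel E ℓ₁ → Rel E ℓ₂ → Rel E (ℓ₁ ⊔ ℓ₂)
(e ∖ʳ r) x y = e x y × ¬ r x y

cl : ∀ {a ℓ} {E : Set a} → Rel E ℓ → Rel E (a ⊔ ℓ)
cl r = TransClosure r

module _ {E : Set} (e : Rel E 0ℓ) where

  IsClosed : Rel E 0ℓ → Set
  IsClosed r = (r ⊆ʳ e) × Transitive r

  IsOpen : Rel E 0ℓ → Set
  IsOpen r = (r ⊆ʳ e) × Transitive (e ∖ʳ r)

  IsClopen : Rel E 0ℓ → Set
  IsClopen r = (r ⊆ʳ e) × Transitive r × Transitive (e ∖ʳ r)

  int : Rel E 0ℓ → Rel E (lsuc 0ℓ)
  int r x y = Σ (Rel E 0ℓ) λ b → IsOpen b × (b ⊆ʳ r) × b x y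

  IsRegularClosed : Rel E 0ℓ → Set₁
  IsRegularClosed r = (r ⊆ʳ e) × (r ≐ʳ cl (int r))

  Reg : Set₁
  Reg = Σ (Rel E 0ℓ) IsRegularClosed

  Clop : Set₁
  Clop = Σ (Rel E 0ℓ) IsClopen

  _≤R_ : Reg → Reg → Set
  a ≤R b = proj₁ a ⊆ʳ proj₁ b

  _≤C_ : Clop → Clop → Set
  c ≤C d = proj₁ c ⊆ʳ proj₁ d

  IsLubReg : (Reg → Set₁) → Reg → Set₁
  IsLubReg S a = (∀ b → S b → b ≤R a) × (∀ u → (∀ b → S b → b ≤R u) → a ≤R u)

  CompletelyJoinIrreducible : Reg → Set₂
  CompletelyJoinIrreducible a =
    ∀ (S : Reg → Set₁) → IsLubReg S a → Σ Reg λ b → S b × (proj₁ b ≐ʳ proj₁ a)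

  -- Dedekind–MacNeille completion of the poset (Clop(e), ⊆) via cuts.
  -- A subset of Clop(e) is a predicate Clop → Set₁.
  Upper : (Clop → Set₁) → Clop → Set₁
  Upper A p = ∀ q → A q → q ≤C p

  Lower : (Clop → Set₁) → Clop → Set₁
  Lower B p = ∀ q → B q → p ≤C q

  -- A is a cut iff A = (A^u)^l; the inclusion A ⊆ (A^u)^l always holds,
  -- so we require the other one.
  IsCut : (Clop → Set₁) → Set₁
  IsCut A = ∀ p → Lower (Upper A) p → A p

  DM : Set₂
  DM = Σ (Clop → Set₁) IsCut

  _≤DM_ : DM → DM → Set₁
  A ≤DM B = ∀ p → proj₁ A p → proj₁ B p

  _≈DM_ : DM → DM → Set₁
  A ≈DM B = (A ≤DM B) × (B ≤DM A)

  ↓_ : Clop → Clop → Set₁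
  (↓ c) p = Level.Lift (lsuc 0ℓ) (p ≤C c)

  -- "Reg(e) is, up to isomorphism, the Dedekind–MacNeille completion of
  -- Clop(e) via the inclusion Clop(e) ⊆ Reg(e)": there is an order
  -- isomorphism φ : Reg(e) → DM(Clop(e)) sending each clopen set to its
  -- principal cut.
  RegIsDMOfClop : Set₂
  RegIsDMOfClop =
    Σ (Reg → DM) λ φ →
        (∀ a b → (a ≤R b → φ a ≤DM φ b) × (φ a ≤DM φ b → a ≤R b))
      × (∀ A → Σ Reg λ a → φ a ≈DM A)
      × (∀ (c : Clop) (a : Reg) → proj₁ a ≐ʳ proj₁ c →
           ∀ p → (proj₁ (φ a) p → (↓ c) p) × ((↓ c) p → proj₁ (φ a) p))

-- The whole argument rests on one density fact (the clopen neighbourhood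
-- lemma): every pair of an open set o lies in a clopen subset of o.  From it:
--   * a regular closed set a = cl (int a) is the union of its clopen
--     subsets, so a ⊆ u for a closed u as soon as every clopen subset of a
--     is contained in u (clopen density);
--   * complements of closed sets are open, hence the complement of the
--     clopen neighbourhood of a pair outside a closed set a is a clopen
--     superset of a avoiding that pair (clopen separation).
-- Sending a ∈ Reg(e) to the set of clopen sets below it is then an order
-- embedding into the cuts of Clop(e) (separation makes the image a cut,
-- density makes the map order-reflecting), and it is onto because the
-- closure of the union of a cut is regular closed and has exactly that
-- cut below it.  Density also shows that every a ∈ Reg(e) is the join of
-- the clopen sets below it, which yields the statement on completely
-- join-irreducible elements.  Excluded middle is used for double-negation
-- elimination and to resize relations living in Set₁ down to Set.

module Submission where

open import Defs
open import Data.Product using (Σ; _×_; proj₁; proj₂; _,_)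
open import Relation.Binary.Core using (Rel)
open import Level using (0ℓ; Lift; lift; lower) renaming (suc to lsuc)
open import Axiom.ExcludedMiddle using (ExcludedMiddle)
open import Axiom.DoubleNegationElimination using (em⇒dne)
open import Relation.Binary.Definitions using (Transitive)
open import Data.Sum using (_⊎_; inj₁; inj₂)
open import Relation.Nullary using (¬_; yes; no)
open import Relation.Nullary.Decidable using (True; toWitness; fromWitness)
open import Relation.Binary.PropositionalEquality using (_≡_; refl)
open import Relation.Binary.Construct.Closure.Transitive
  using (TransClosure; [_]; _∷_; _++_; transitive⁻)

cl-map : ∀ {a ℓ ℓ'} {E : Set a} {r : Rel E ℓ} {s : Rel E ℓ'} →
         r ⊆ʳ s → cl r ⊆ʳ cl s
cl-map f [ p ]    = [ f p ]
cl-map f (p ∷ ps) = f p ∷ cl-map f ps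

cl-least : ∀ {a ℓ ℓ'} {E : Set a} {r : Rel E ℓ} {s : Rel E ℓ'} →
           Transitive s → r ⊆ʳ s → cl r ⊆ʳ s
cl-least {s = s} s-trans r⊆s p = transitive⁻ s s-trans (cl-map r⊆s p)

module _ {E : Set} (e : Rel E 0ℓ) where

  open⊆int : ∀ {b a : Rel E 0ℓ} → IsOpen e b → b ⊆ʳ a → b ⊆ʳ int e a
  open⊆int b-open b⊆a p = _ , b-open , b⊆a , p

  closed⇒regular : ∀ {a : Rel E 0ℓ} → IsClosed e a → a ⊆ʳ cl (int e a) →
                   IsRegularClosed e a
  closed⇒regular (a⊆e , a-trans) a⊆clint =
    a⊆e , a⊆clint , cl-least a-trans λ { (_ , _ , b⊆a , p) → b⊆a p }

  regular⇒transitive : (a : Reg e) → Transitive (proj₁ a)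
  regular⇒transitive (_ , _ , a⊆clint , clint⊆a) p q =
    clint⊆a (a⊆clint p ++ a⊆clint q)

  regular⇒closed : (a : Reg e) → IsClosed e (proj₁ a)
  regular⇒closed a = proj₁ (proj₂ a) , regular⇒transitive a

  -- A clopen set is open, hence contained in its own interior.
  clopen⇒regular : (c : Clop e) → IsRegularClosed e (proj₁ c)
  clopen⇒regular (c , c⊆e , c-trans , c-cotrans) =
    closed⇒regular (c⊆e , c-trans) λ p → [ open⊆int (c⊆e , c-cotrans) (λ q → q) p ]

  clop→reg : Clop e → Reg e
  clop→reg c = proj₁ c , clopen⇒regular c

  clopen-resp-≐ : ∀ {a b : Rel E 0ℓ} → a ≐ʳ b → IsClopen e a → IsClopen e b
  clopen-resp-≐ (a⊆b , b⊆a) (a⊆e , a-trans , a-cotrans) =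
    (λ p → a⊆e (b⊆a p)) ,
    (λ p q → a⊆b (a-trans (b⊆a p) (b⊆a q))) ,
    λ (euv , ¬buv) (evw , ¬bvw) →
      let (euw , ¬auw) = a-cotrans (euv , λ p → ¬buv (a⊆b p)) (evw , λ p → ¬bvw (a⊆b p))
      in euw , λ p → ¬auw (b⊆a p)

module _ (lem : ∀ {ℓ} → ExcludedMiddle ℓ)
         {E : Set} (e : Rel E 0ℓ) (e-trans : Transitive e) where

  dne : {P : Set} → ¬ ¬ P → P
  dne = em⇒dne lem

  -- For o open and o x y, put
  --   D = {x} ∪ {u | e x u, ¬ o x u},
  --   C = {(u , v) ∈ e | u ∈ D, v ∉ D or v = y}.
  -- C is transitive because its constraints concern only the endpoints;
  -- e ∖ C is transitive by splitting on whether the middle point is in D;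
  -- and C ⊆ o because e ∖ o is transitive.
  clopen-neighbourhood : ∀ {o : Rel E 0ℓ} → IsOpen e o → ∀ {x y} → o x y →
                         Σ (Clop e) λ c → proj₁ c x y × (proj₁ c ⊆ʳ o)
  clopen-neighbourhood {o} (o⊆e , o-cotrans) {x} {y} oxy =
    (C , proj₁ , C-trans , C-cotrans) , (o⊆e oxy , inj₁ refl , inj₂ refl) , C⊆o
    where
    D : E → Set
    D u = (u ≡ x) ⊎ (e x u × ¬ o x u)

    C : Rel E 0ℓ
    C u v = e u v × D u × (¬ D v ⊎ v ≡ y)

    C-trans : Transitive C
    C-trans (euv , Du , _) (evw , _ , w-ok) = e-trans euv evw , Du , w-ok

    C-cotrans : Transitive (e ∖ʳ C)
    C-cotrans {u} {v} {w} (euv , ¬Cuv) (evw , ¬Cvw) = e-trans euv evw , ¬Cuw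
      where
      ¬Cuw : ¬ C u w
      ¬Cuw (_ , Du , w-ok) with lem {P = D v}
      ... | yes Dv = ¬Cvw (evw , Dv , w-ok)
      ... | no ¬Dv = ¬Cuv (euv , Du , inj₁ ¬Dv)

    C⊆o : C ⊆ʳ o
    C⊆o (euv , inj₁ refl , inj₁ ¬Dv) = dne λ ¬oxv → ¬Dv (inj₂ (euv , ¬oxv))
    C⊆o (euv , inj₂ x∖ou , inj₁ ¬Dv) =
      dne λ ¬ouv → ¬Dv (inj₂ (o-cotrans x∖ou (euv , ¬ouv)))
    C⊆o (euv , inj₁ refl , inj₂ refl) = oxy
    C⊆o (euv , inj₂ x∖ou , inj₂ refl) =
      dne λ ¬ouy → proj₂ (o-cotrans x∖ou (euv , ¬ouy)) oxy

  closed⇒complement-open : ∀ {a : Rel E 0ℓ} → IsClosed e a → IsOpen e (e ∖ʳ a)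
  closed⇒complement-open (_ , a-trans) =
    proj₁ ,
    λ (euv , ¬∖uv) (evw , ¬∖vw) →
      e-trans euv evw ,
      λ (_ , ¬auw) → ¬auw (a-trans (dne λ ¬a → ¬∖uv (euv , ¬a))
                                   (dne λ ¬a → ¬∖vw (evw , ¬a)))

  complement : Clop e → Clop e
  complement (c , c⊆e , c-trans , c-cotrans) =
    (e ∖ʳ c) , proj₁ , c-cotrans , proj₂ (closed⇒complement-open (c⊆e , c-trans))

  clopen-separation : ∀ {a : Rel E 0ℓ} → IsClosed e a → ∀ {x y} → e x y → ¬ a x y →
                      Σ (Clop e) λ q → (a ⊆ʳ proj₁ q) × ¬ proj₁ q x y
  clopen-separation a-closed exy ¬axy
    with clopen-neighbourhood (closed⇒complement-open a-closed) (exy , ¬axy)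
  ... | c , cxy , c⊆∖a =
    complement c ,
    (λ auv → proj₁ a-closed auv , λ cuv → proj₂ (c⊆∖a cuv) auv) ,
    λ (_ , ¬cxy) → ¬cxy cxy

  -- Clopen density: a regular closed set lies below a transitive u as soon
  -- as all of its clopen subsets do, since int a is covered by them.
  clopen-density : (a : Reg e) {u : Rel E 0ℓ} → Transitive u →
                   (∀ (c : Clop e) → proj₁ c ⊆ʳ proj₁ a → proj₁ c ⊆ʳ u) →
                   proj₁ a ⊆ʳ u
  clopen-density (a , _ , a⊆clint , _) {u} u-trans below p =
    cl-least u-trans int⊆u (a⊆clint p)
    where
    int⊆u : int e a ⊆ʳ u
    int⊆u (_ , b-open , b⊆a , buv) with clopen-neighbourhood b-open buv
    ... | c , cuv , c⊆b = below c (λ q → b⊆a (c⊆b q)) cuv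

  clopens-below : Reg e → Clop e → Set₁
  clopens-below a c = Lift (lsuc 0ℓ) (proj₁ c ⊆ʳ proj₁ a)

  -- By separation, the clopen sets below a form a cut of Clop(e).
  clopens-below-cut : (a : Reg e) → IsCut e (clopens-below a)
  clopens-below-cut a p p-lower =
    lift λ pxy → dne λ ¬axy →
      let (q , a⊆q , ¬qxy) =
            clopen-separation (regular⇒closed e a) (proj₁ (proj₂ p) pxy) ¬axy
      in ¬qxy (p-lower q (λ c c-below cuv → a⊆q (lower c-below cuv)) pxy)

  φ : Reg e → DM e
  φ a = clopens-below a , clopens-below-cut a

  -- φ preserves order trivially and reflects it by clopen density.
  φ-order-embedding : ∀ a b → (_≤R_ e a b → _≤DM_ e (φ a) (φ b))
                            × (_≤DM_ e (φ a) (φ b) → _≤R_ e a b)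
  φ-order-embedding a b =
    (λ a⊆b c c⊆a → lift λ p → a⊆b (lower c⊆a p)) ,
    λ φa⊆φb → clopen-density a (regular⇒transitive e b)
                (λ c c⊆a → lower (φa⊆φb c (lift c⊆a)))

  -- Resizing, by excluded middle, of the closure of the union of a family
  -- of clopen sets; it is the join of the family in Reg(e).
  ⋁ : (Clop e → Set₁) → Rel E 0ℓ
  ⋁ A u v = True (lem {P = cl (λ s t → Σ (Clop e) λ c → A c × proj₁ c s t) u v})

  ⋁-upper : ∀ A c → A c → proj₁ c ⊆ʳ ⋁ A
  ⋁-upper A c Ac p = fromWitness [ c , Ac , p ]

  ⋁-least : ∀ A q → Upper e A q → ⋁ A ⊆ʳ proj₁ q
  ⋁-least A q q-upper p =
    cl-least (proj₁ (proj₂ (proj₂ q))) (λ (c , Ac , cuv) → q-upper c Ac cuv) (toWitness p)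

  -- The join is closed, and covered by the members, which are open subsets.
  ⋁-regular : ∀ A → IsRegularClosed e (⋁ A)
  ⋁-regular A = closed⇒regular e ⋁-closed λ p → cl-map generator⊆int (toWitness p)
    where
    ⋁-closed : IsClosed e (⋁ A)
    ⋁-closed =
      (λ p → cl-least e-trans (λ (c , _ , cuv) → proj₁ (proj₂ c) cuv) (toWitness p)) ,
      λ p q → fromWitness (toWitness p ++ toWitness q)

    generator⊆int : ∀ {u v} → (Σ (Clop e) λ c → A c × proj₁ c u v) → int e (⋁ A) u v
    generator⊆int (c , Ac , cuv) =
      open⊆int e (proj₁ (proj₂ c) , proj₂ (proj₂ (proj₂ c))) (⋁-upper A c Ac) cuv

  φ-surjective : ∀ A → Σ (Reg e) λ a → _≈DM_ e (φ a) A
  φ-surjective (A , A-cut) =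
    (⋁ A , ⋁-regular A) ,
    (λ c c⊆⋁A → A-cut c λ q q-upper cuv → ⋁-least A q q-upper (lower c⊆⋁A cuv)) ,
    λ c Ac → lift (⋁-upper A c Ac)

  φ-principal : ∀ (c : Clop e) (a : Reg e) → proj₁ a ≐ʳ proj₁ c →
                ∀ p → (proj₁ (φ a) p → (↓_) e c p) × ((↓_) e c p → proj₁ (φ a) p)
  φ-principal c a (a⊆c , c⊆a) p =
    (λ p⊆a → lift λ q → a⊆c (lower p⊆a q)) , λ p⊆c → lift λ q → c⊆a (lower p⊆c q)

  reg-is-DM-of-clop : RegIsDMOfClop e
  reg-is-DM-of-clop = φ , φ-order-embedding , φ-surjective , φ-principal

  join-of-clopens-below : (a : Reg e) →
    IsLubReg e (λ b → Lift (lsuc 0ℓ) (IsClopen e (proj₁ b) × _≤R_ e b a)) a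
  join-of-clopens-below a =
    (λ b b-in → proj₂ (lower b-in)) ,
    λ u u-upper → clopen-density a (regular⇒transitive e u)
                    (λ c c⊆a → u-upper (clop→reg e c) (lift (proj₂ c , c⊆a)))

  completely-join-irreducible⇒clopen :
    ∀ (a : Reg e) → CompletelyJoinIrreducible e a → IsClopen e (proj₁ a)
  completely-join-irreducible⇒clopen a a-cji
    with a-cji _ (join-of-clopens-below a)
  ... | b , lift (b-clopen , _) , b≐a = clopen-resp-≐ e b≐a b-clopen

corollary5p6 : (lem : ∀ {ℓ} → ExcludedMiddle ℓ) →
    ∀ {E : Set} (e : Rel E 0ℓ) → Transitive e →
      RegIsDMOfClop e
        × (∀ (a : Reg e) → CompletelyJoinIrreducible e a → IsClopen e (proj₁ a))
corollary5p6 lem e e-trans =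
  reg-is-DM-of-clop lem e e-trans ,
  completely-join-irreducible⇒clopen lem e e-trans
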